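{- Let $X\in\{\mathrm{K4\times S5},\mathrm{S4\times S5},\mathrm{SSL}\}$ and let $\varphi$ be a bimodal formula. For the transitive relation $\leq_X$ on $\mathcal{P}(\mathcal{T}^X_\varphi)$: (1) if $X\in\{\mathrm{K4\times S5},\mathrm{S4\times S5}\}$ then $\mathrm{mcl}(\leq_X)\leq 4\cdot|\mathcal{T}^X_\varphi|$; (2) $\mathrm{mcl}(\leq_{\mathrm{SSL}})\leq 2\cdot|\mathcal{T}^{\mathrm{SSL}}_\varphi|$.
   Context: Bimodal formulas are built from propositional variables (set $AT$) by $\neg$, $\wedge$, $K$, $\Box$. $\mathrm{sf}(\varphi)$ is the set of subformulas; $\mathcal{L}_\Box$ is the set of formulas of the form $\Box\chi$. A $\mathrm{K4\times S5}$-tableau-set w.r.t. $\varphi$ is $F\subseteq\mathrm{sf}(\varphi)$ with (a) $\neg\chi\in F\iff\chi\notin F$; (b) $(\chi_1\wedge\chi_2)\in F\iff\chi_1,\chi_2\in F$; (c) $K\chi\in F\Rightarrow\chi\in F$ (for formulas in $\mathrm{sf}(\varphi)$); $\mathrm{S4\times S5}$-/$\mathrm{SSL}$-tableau-sets also satisfy (d) $\Box\chi\in F\Rightarrow\chi\in F$. $\mathcal{T}^X_\varphi$ = set of $X$-tableau-sets. $F\preccurlyeq_X G$: for $\mathrm{K4\times S5}$, $F\cap\mathcal{L}_\Box\subseteq G$ and $\{\psi:\Box\psi\in F\}\subseteq G$; for $\mathrm{S4\times S5}$, $F\cap\mathcal{L}_\Box\subseteq G$; for $\mathrm{SSL}$,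 $F\cap\mathcal{L}_\Box\subseteq G$ and $F\cap AT=G\cap AT$. For $\mathcal{F},\mathcal{G}\subseteq\mathcal{T}^X_\varphi$, $\mathcal{F}\leq_X\mathcal{G}$: every $G\in\mathcal{G}$ has $F\in\mathcal{F}$ with $F\preccurlyeq_X G$, and (only for $X\neq\mathrm{SSL}$) every $F\in\mathcal{F}$ has $G\in\mathcal{G}$ with $F\preccurlyeq_X G$. For a relation $\leq$, $s<t$ means ($s\leq t$ and not $t\leq s$); for a transitive relation on a finite nonempty set, $\mathrm{mcl}(\leq)$ is the largest $l$ such that there is a chain $s_0<s_1<\dots<s_l$. -}

module Defs where

open import Data.Nat using (ℕ; zero; suc; _≤_)
import Data.Nat.Properties as ℕP
open import Data.Bool using (Bool)
open import Data.List using (List; []; _∷_; _++_; length; deduplicate; lookup)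
open import Data.List.Membership.Propositional using (_∈_)
open import Data.List.Relation.Unary.Unique.Propositional using (Unique)
open import Data.Fin using (Fin; inject₁) renaming (suc to fsuc)
open import Data.Fin.Subset using (Subset) renaming (_∈_ to _∈ˢ_)
open import Data.Empty using (⊥)
open import Data.Unit using (⊤)
open import Data.Product using (Σ; _×_; _,_)
open import Relation.Nullary using (¬_; Dec; yes; no)
open import Relation.Binary.PropositionalEquality using (_≡_; refl; cong; cong₂)
open import Relation.Binary.Definitions using (DecidableEquality)
open import Function.Bundles using (_⇔_)

AT : Set
AT = ℕ

data Fm : Set where
  var  : AT → Fm
  neg  : Fm → Fm
  _∧_  : Fm → Fm → Fm
  K    : Fm → Fm
  box  : Fm → Fm

_≟ᶠ_ : DecidableEquality Fm
var p ≟ᶠ var q with p ℕP.≟ q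
... | yes refl = yes refl
... | no ne = no λ { refl → ne refl }
var _ ≟ᶠ neg _ = no λ ()
var _ ≟ᶠ (_ ∧ _) = no λ ()
var _ ≟ᶠ K _ = no λ ()
var _ ≟ᶠ box _ = no λ ()
neg _ ≟ᶠ var _ = no λ ()
neg a ≟ᶠ neg b with a ≟ᶠ b
... | yes refl = yes refl
... | no ne = no λ { refl → ne refl }
neg _ ≟ᶠ (_ ∧ _) = no λ ()
neg _ ≟ᶠ K _ = no λ ()
neg _ ≟ᶠ box _ = no λ ()
(_ ∧ _) ≟ᶠ var _ = no λ ()
(_ ∧ _) ≟ᶠ neg _ = no λ ()
(a ∧ b) ≟ᶠ (c ∧ d) with a ≟ᶠ c | b ≟ᶠ d
... | yes refl | yes refl = yes refl
... | no ne | _ = no λ { refl → ne refl }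
... | yes _ | no ne = no λ { refl → ne refl }
(_ ∧ _) ≟ᶠ K _ = no λ ()
(_ ∧ _) ≟ᶠ box _ = no λ ()
K _ ≟ᶠ var _ = no λ ()
K _ ≟ᶠ neg _ = no λ ()
K _ ≟ᶠ (_ ∧ _) = no λ ()
K a ≟ᶠ K b with a ≟ᶠ b
... | yes refl = yes refl
... | no ne = no λ { refl → ne refl }
K _ ≟ᶠ box _ = no λ ()
box _ ≟ᶠ var _ = no λ ()
box _ ≟ᶠ neg _ = no λ ()
box _ ≟ᶠ (_ ∧ _) = no λ ()
box _ ≟ᶠ K _ = no λ ()
box a ≟ᶠ box b with a ≟ᶠ b
... | yes refl = yes refl
... | no ne = no λ { refl → ne refl }

sf : Fm → List Fm
sf (var p)   = var p ∷ []
sf (neg a)   = neg a ∷ sf a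
sf (a ∧ b)   = (a ∧ b) ∷ (sf a ++ sf b)
sf (K a)     = K a ∷ sf a
sf (box a)   = box a ∷ sf a

sfs : Fm → List Fm
sfs φ = deduplicate _≟ᶠ_ (sf φ)

nsf : Fm → ℕ
nsf φ = length (sfs φ)

-- A subset F ⊆ sf(φ) is a bit vector indexed by the enumeration sfs φ.
SfSet : Fm → Set
SfSet φ = Subset (nsf φ)

_∈[_]_ : Fm → (φ : Fm) → SfSet φ → Set
ψ ∈[ φ ] F = Σ (Fin (nsf φ)) λ i → (lookup (sfs φ) i ≡ ψ) × (i ∈ˢ F)

data Logic : Set where
  K4×S5 S4×S5 SSL : Logic

HasCondD : Logic → Set
HasCondD K4×S5 = ⊥
HasCondD S4×S5 = ⊤
HasCondD SSL   = ⊤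

record IsTableauSet (X : Logic) (φ : Fm) (F : SfSet φ) : Set where
  field
    condNeg : ∀ χ → neg χ ∈ sf φ → ((neg χ ∈[ φ ] F) ⇔ (¬ (χ ∈[ φ ] F)))
    condAnd : ∀ χ₁ χ₂ → (χ₁ ∧ χ₂) ∈ sf φ →
              (((χ₁ ∧ χ₂) ∈[ φ ] F) ⇔ ((χ₁ ∈[ φ ] F) × (χ₂ ∈[ φ ] F)))
    condK   : ∀ χ → K χ ∈[ φ ] F → χ ∈[ φ ] F
    condBox : HasCondD X → ∀ χ → box χ ∈[ φ ] F → χ ∈[ φ ] F

Prec : Logic → (φ : Fm) → SfSet φ → SfSet φ → Set
Prec K4×S5 φ F G = (∀ χ → box χ ∈[ φ ] F → box χ ∈[ φ ] G)
                 × (∀ ψ → box ψ ∈[ φ ] F → ψ ∈[ φ ] G)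
Prec S4×S5 φ F G = ∀ χ → box χ ∈[ φ ] F → box χ ∈[ φ ] G
Prec SSL   φ F G = (∀ χ → box χ ∈[ φ ] F → box χ ∈[ φ ] G)
                 × (∀ p → (var p ∈[ φ ] F) ⇔ (var p ∈[ φ ] G))

-- 𝒯^X_φ, given as a repetition-free enumeration L; |𝒯^X_φ| = length L.

record Enumerates (X : Logic) (φ : Fm) (L : List (SfSet φ)) : Set where
  field
    noDup    : Unique L
    complete : ∀ F → IsTableauSet X φ F ⇔ (F ∈ L)

-- subsets of 𝒯^X_φ : bit vectors over the enumeration L
PSet : (φ : Fm) → List (SfSet φ) → Set
PSet φ L = Subset (length L)

HasForth : Logic → Set
HasForth K4×S5 = ⊤
HasForth S4×S5 = ⊤
HasForth SSL   = ⊥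

Leq : (X : Logic) (φ : Fm) (L : List (SfSet φ)) → PSet φ L → PSet φ L → Set
Leq X φ L 𝓕 𝓖 =
    (∀ j → j ∈ˢ 𝓖 → Σ (Fin (length L)) λ i → (i ∈ˢ 𝓕) × Prec X φ (lookup L i) (lookup L j))
  × (HasForth X →
     ∀ i → i ∈ˢ 𝓕 → Σ (Fin (length L)) λ j → (j ∈ˢ 𝓖) × Prec X φ (lookup L i) (lookup L j))

Strict : {A : Set} → (A → A → Set) → A → A → Set
Strict R s t = R s t × ¬ R t s

Chain : {A : Set} → (A → A → Set) → ℕ → Set
Chain {A} R l = Σ (Fin (suc l) → A) λ s → ∀ (k : Fin l) → Strict R (s (inject₁ k)) (s (fsuc k))

MclAtMost : {A : Set} → (A → A → Set) → ℕ → Set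
MclAtMost R b = ∀ l → Chain R l → l ≤ b

module Submission where

-- Only two features of ≼_X matter: it is transitive, and ≤_X compares
-- subsets of an n-element set (n = |𝒯^X_φ|) by a "back" clause (every element of 𝓖
-- has a ≼-predecessor in 𝓕) and possibly a "forth" clause (every element of 𝓕 has a
-- ≼-successor in 𝓖).  A relation has mcl ≤ b as soon as it admits a *ranking*: a
-- measure bounded by b that does not increase along the relation and can only stay
-- put along a step that is reversible, so that it strictly drops along strict steps.
-- Rankings add up over conjunctions of relations.  The back clause is ranked by the
-- sizes of ↑𝓕 and 𝓕 ∪ ↑𝓕 (↑ = set of ≼-successors), because 𝓕 ≤ 𝓖 sandwiches
-- 𝓖 ∪ ↑𝓖 ⊆ ↑𝓕 ⊆ 𝓕 ∪ ↑𝓕; dually the forth clause is ranked by the sizes of the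
-- complements of ↓𝓕 and 𝓕 ∪ ↓𝓕.  Each ranking is bounded by 2n, giving 4n when both
-- clauses are present and 2n for SSL.  The ranking argument needs ≼ decidable; this
-- holds up to double negation, which suffices because the conclusion l ≤ b is
-- decidable.

open import Defs
open import Data.Nat using (ℕ; _*_; _+_; _≤_; _<_; _≤?_; zero; suc; z≤n; s≤s)
open import Data.Nat.Properties
  using (≤-trans; ≤-reflexive; +-mono-≤; +-monoʳ-≤; +-monoˡ-≤; +-cancelʳ-≤; +-cancelˡ-≤; ≰⇒>; ≤⇒≯)
open import Data.Nat.Tactic.RingSolver using (solve-∀)
open import Data.List using (List; length; lookup)
open import Data.Vec using (tabulate)
open import Data.Vec.Properties using (lookup∘tabulate; []=⇒lookup; lookup⇒[]=)
open import Data.Fin using (Fin) renaming (zero to fzero; suc to fsuc)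
open import Data.Fin.Properties using (any?)
open import Data.Fin.Subset using (Subset; _∈_; _⊆_; _∪_; ∁; ∣_∣)
open import Data.Fin.Subset.Properties
  using (_∈?_; p⊆q⇒∣p∣≤∣q∣; ∣p∣≤n; p⊂q⇒∣p∣<∣q∣; p⊆p∪q; q⊆p∪q; x∈p∪q⁻; p⊆q⇒∁p⊇∁q; ∁p⊆∁q⇒p⊇q)
open import Data.Product using (Σ; _×_; _,_; proj₁)
open import Data.Sum using (_⊎_; inj₁; inj₂)
open import Data.Unit using (tt)
open import Data.Bool using (true)
open import Relation.Nullary using (¬_; Dec; yes; no; contradiction)
open import Relation.Nullary.Decidable using (_×-dec_; decidable-stable; ¬¬-excluded-middle)
open import Relation.Binary.PropositionalEquality using (_≡_; refl; sym; trans)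
open import Function.Bundles using (mk⇔; Equivalence)

select : ∀ {n} {P : Fin n → Set} → (∀ i → Dec (P i)) → Subset n
select P? = tabulate (λ i → Dec.does (P? i))

select-sound : ∀ {n} {P : Fin n → Set} (P? : ∀ i → Dec (P i)) {i} → i ∈ select P? → P i
select-sound P? {i} i∈ with P? i | trans (sym (lookup∘tabulate (λ k → Dec.does (P? k)) i)) ([]=⇒lookup i∈)
... | yes p | _ = p
... | no _  | ()

select-complete : ∀ {n} {P : Fin n → Set} (P? : ∀ i → Dec (P i)) {i} → P i → i ∈ select P?
select-complete P? {i} p = lookup⇒[]= i _ (trans (lookup∘tabulate (λ k → Dec.does (P? k)) i) (is-true (P? i)))
  where
  is-true : (d : Dec _) → Dec.does d ≡ true
  is-true (yes _) = refl
  is-true (no ¬p) = contradiction p ¬p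

⊆-by-size : ∀ {n} {p q : Subset n} → p ⊆ q → ∣ q ∣ ≤ ∣ p ∣ → q ⊆ p
⊆-by-size {p = p} p⊆q ∣q∣≤∣p∣ {x} x∈q with x ∈? p
... | yes x∈p = x∈p
... | no  x∉p = contradiction (p⊂q⇒∣p∣<∣q∣ (p⊆q , x , x∈q , x∉p)) (≤⇒≯ ∣q∣≤∣p∣)

+-no-shrink : ∀ {x x′ y y′} → x′ ≤ x → y′ ≤ y → x + y ≤ x′ + y′ → (x ≤ x′) × (y ≤ y′)
+-no-shrink {x} {x′} {y} {y′} x′≤x y′≤y sum≤ =
  +-cancelʳ-≤ y x x′ (≤-trans sum≤ (+-monoʳ-≤ x′ y′≤y)) ,
  +-cancelˡ-≤ x y y′ (≤-trans sum≤ (+-monoˡ-≤ y′ x′≤x))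

record Ranking {A : Set} (_⊑_ : A → A → Set) (bound : ℕ) : Set where
  field
    rank     : A → ℕ
    bounded  : ∀ a → rank a ≤ bound
    antitone : ∀ {a c} → a ⊑ c → rank c ≤ rank a
    reflects : ∀ {a c} → a ⊑ c → rank a ≤ rank c → c ⊑ a

  strict-descent : ∀ {a c} → Strict _⊑_ a c → rank c < rank a
  strict-descent {a} {c} (a⊑c , c⋢a) with rank a ≤? rank c
  ... | yes ≤ = contradiction (reflects a⊑c ≤) c⋢a
  ... | no  ≰ = ≰⇒> ≰

  chain-rank : ∀ l → (chain : Chain _⊑_ l) → l ≤ rank (proj₁ chain fzero)
  chain-rank zero    _            = z≤n
  chain-rank (suc l) (s , steps) =
    ≤-trans (s≤s (chain-rank l ((λ k → s (fsuc k)) , (λ k → steps (fsuc k)))))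
            (strict-descent (steps fzero))

  mcl-bound : MclAtMost _⊑_ bound
  mcl-bound l chain = ≤-trans (chain-rank l chain) (bounded _)

ranking-map : ∀ {A : Set} {R S : A → A → Set} {b} →
  (∀ {a c} → R a c → S a c) → (∀ {a c} → S a c → R a c) → Ranking R b → Ranking S b
ranking-map R⇒S S⇒R ρ = record
  { rank     = rank
  ; bounded  = bounded
  ; antitone = λ aSc → antitone (S⇒R aSc)
  ; reflects = λ aSc ≤ → R⇒S (reflects (S⇒R aSc) ≤)
  }
  where open Ranking ρ

ranking-weaken : ∀ {A : Set} {R : A → A → Set} {b b′} → b ≤ b′ → Ranking R b → Ranking R b′
ranking-weaken b≤b′ ρ = record
  { rank     = rank
  ; bounded  = λ a → ≤-trans (bounded a) b≤b′
  ; antitone = antitone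
  ; reflects = reflects
  }
  where open Ranking ρ

ranking-× : ∀ {A : Set} {R S : A → A → Set} {b b′} →
  Ranking R b → Ranking S b′ → Ranking (λ a c → R a c × S a c) (b + b′)
ranking-× ρ σ = record
  { rank     = λ a → ρ.rank a + σ.rank a
  ; bounded  = λ a → +-mono-≤ (ρ.bounded a) (σ.bounded a)
  ; antitone = λ (aRc , aSc) → +-mono-≤ (ρ.antitone aRc) (σ.antitone aSc)
  ; reflects = λ (aRc , aSc) ≤ →
      let (≤ρ , ≤σ) = +-no-shrink (ρ.antitone aRc) (σ.antitone aSc) ≤
      in ρ.reflects aRc ≤ρ , σ.reflects aSc ≤σ
  }
  where
  module ρ = Ranking ρ
  module σ = Ranking σ

record Sandwich {A : Set} (_⊑_ : A → A → Set) (n : ℕ) : Set where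
  field
    inner outer : A → Subset n
    inner⊆outer : ∀ a → inner a ⊆ outer a
    squeeze     : ∀ {a c} → a ⊑ c → outer c ⊆ inner a
    unsqueeze   : ∀ {a c} → outer a ⊆ inner c → c ⊑ a

-- Sandwiched relations are ranked by |inner| + |outer|: along a ⊑ c both sets shrink,
-- and if their sizes do not, the chain outer a ⊆ outer c ⊆ inner a ⊆ inner c closes.
sandwich-ranking : ∀ {A : Set} {_⊑_ : A → A → Set} {n} → Sandwich _⊑_ n → Ranking _⊑_ (n + n)
sandwich-ranking {_⊑_ = _⊑_} {n} σ = record
  { rank     = rank
  ; bounded  = λ a → +-mono-≤ (∣p∣≤n (inner a)) (∣p∣≤n (outer a))
  ; antitone = λ a⊑c → +-mono-≤ (p⊆q⇒∣p∣≤∣q∣ (inner-shrinks a⊑c)) (p⊆q⇒∣p∣≤∣q∣ (outer-shrinks a⊑c))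
  ; reflects = reflects
  }
  where
  open Sandwich σ

  rank : _ → ℕ
  rank a = ∣ inner a ∣ + ∣ outer a ∣

  inner-shrinks : ∀ {a c} → a ⊑ c → inner c ⊆ inner a
  inner-shrinks {c = c} a⊑c x∈ = squeeze a⊑c (inner⊆outer c x∈)

  outer-shrinks : ∀ {a c} → a ⊑ c → outer c ⊆ outer a
  outer-shrinks {a} a⊑c x∈ = inner⊆outer a (squeeze a⊑c x∈)

  reflects : ∀ {a c} → a ⊑ c → rank a ≤ rank c → c ⊑ a
  reflects a⊑c ≤ with +-no-shrink (p⊆q⇒∣p∣≤∣q∣ (inner-shrinks a⊑c)) (p⊆q⇒∣p∣≤∣q∣ (outer-shrinks a⊑c)) ≤
  ... | ∣inner∣≤ , ∣outer∣≤ =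
    unsqueeze λ x∈ →
      ⊆-by-size (inner-shrinks a⊑c) ∣inner∣≤ (squeeze a⊑c (⊆-by-size (outer-shrinks a⊑c) ∣outer∣≤ x∈))

module BackAndForth {n : ℕ} (R : Fin n → Fin n → Set) (R? : ∀ i j → Dec (R i j))
                    (R-trans : ∀ {i j k} → R i j → R j k → R i k) where

  Back : Subset n → Subset n → Set
  Back F G = ∀ j → j ∈ G → Σ (Fin n) λ i → (i ∈ F) × R i j

  Forth : Subset n → Subset n → Set
  Forth F G = ∀ i → i ∈ F → Σ (Fin n) λ j → (j ∈ G) × R i j

  pred-in? : ∀ S y → Dec (Σ (Fin n) λ x → (x ∈ S) × R x y)
  pred-in? S y = any? λ x → (x ∈? S) ×-dec R? x y

  succ-in? : ∀ S x → Dec (Σ (Fin n) λ y → (y ∈ S) × R x y)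
  succ-in? S x = any? λ y → (y ∈? S) ×-dec R? x y

  ↑ ↓ : Subset n → Subset n
  ↑ S = select (pred-in? S)
  ↓ S = select (succ-in? S)

  ∈↑⁻ : ∀ {S y} → y ∈ ↑ S → Σ (Fin n) λ x → (x ∈ S) × R x y
  ∈↑⁻ {S} = select-sound (pred-in? S)

  ∈↑⁺ : ∀ {S y} → (Σ (Fin n) λ x → (x ∈ S) × R x y) → y ∈ ↑ S
  ∈↑⁺ {S} = select-complete (pred-in? S)

  ∈↓⁻ : ∀ {S x} → x ∈ ↓ S → Σ (Fin n) λ y → (y ∈ S) × R x y
  ∈↓⁻ {S} = select-sound (succ-in? S)

  ∈↓⁺ : ∀ {S x} → (Σ (Fin n) λ y → (y ∈ S) × R x y) → x ∈ ↓ S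
  ∈↓⁺ {S} = select-complete (succ-in? S)

  back-⊆ : ∀ {F G} → Back F G → G ∪ ↑ G ⊆ ↑ F
  back-⊆ {F} {G} back {j} j∈ with x∈p∪q⁻ G (↑ G) j∈
  ... | inj₁ j∈G = ∈↑⁺ (back j j∈G)
  ... | inj₂ j∈↑G with ∈↑⁻ j∈↑G
  ...   | y , y∈G , Ryj with back y y∈G
  ...     | i , i∈F , Riy = ∈↑⁺ (i , i∈F , R-trans Riy Ryj)

  forth-⊆ : ∀ {F G} → Forth F G → F ∪ ↓ F ⊆ ↓ G
  forth-⊆ {F} {G} forth {i} i∈ with x∈p∪q⁻ F (↓ F) i∈
  ... | inj₁ i∈F = ∈↓⁺ (forth i i∈F)
  ... | inj₂ i∈↓F with ∈↓⁻ i∈↓F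
  ...   | y , y∈F , Riy with forth y y∈F
  ...     | j , j∈G , Ryj = ∈↓⁺ (j , j∈G , R-trans Riy Ryj)

  back-sandwich : Sandwich Back n
  back-sandwich = record
    { inner       = ↑
    ; outer       = λ S → S ∪ ↑ S
    ; inner⊆outer = λ S → q⊆p∪q S (↑ S)
    ; squeeze     = back-⊆
    ; unsqueeze   = λ {F} F∪↑F⊆↑G j j∈F → ∈↑⁻ (F∪↑F⊆↑G (p⊆p∪q (↑ F) j∈F))
    }

  forth-sandwich : Sandwich Forth n
  forth-sandwich = record
    { inner       = λ S → ∁ (S ∪ ↓ S)
    ; outer       = λ S → ∁ (↓ S)
    ; inner⊆outer = λ S → p⊆q⇒∁p⊇∁q (q⊆p∪q S (↓ S))
    ; squeeze     = λ F≤G → p⊆q⇒∁p⊇∁q (forth-⊆ F≤G)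
    ; unsqueeze   = λ {F} {G} ∁↓F⊆∁G∪↓G i i∈G → ∈↓⁻ (∁p⊆∁q⇒p⊇q ∁↓F⊆∁G∪↓G (p⊆p∪q (↓ G) i∈G))
    }

  back-forth-ranking : ∀ {H : Set} → H → Ranking (λ F G → Back F G × (H → Forth F G)) (4 * n)
  back-forth-ranking h = ranking-map (λ (b , f) → b , λ _ → f) (λ (b , f) → b , f h)
    (ranking-weaken (≤-reflexive (four n)) ρ)
    where
    ρ : Ranking (λ F G → Back F G × Forth F G) ((n + n) + (n + n))
    ρ = ranking-× (sandwich-ranking back-sandwich) (sandwich-ranking forth-sandwich)
    four : ∀ n → (n + n) + (n + n) ≡ 4 * n
    four = solve-∀

  back-ranking : ∀ {H : Set} → ¬ H → Ranking (λ F G → Back F G × (H → Forth F G)) (2 * n)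
  back-ranking ¬h = ranking-map (λ b → b , λ h → contradiction h ¬h) proj₁
    (ranking-weaken (≤-reflexive (two n)) ρ)
    where
    ρ : Ranking Back (n + n)
    ρ = sandwich-ranking back-sandwich
    two : ∀ n → n + n ≡ 2 * n
    two = solve-∀

Prec-trans : ∀ X φ {F G H} → Prec X φ F G → Prec X φ G H → Prec X φ F H
Prec-trans K4×S5 φ (□F⊆□G , □F⊆G) (□G⊆□H , □G⊆H) =
  (λ χ □χ → □G⊆□H χ (□F⊆□G χ □χ)) , (λ ψ □ψ → □G⊆H ψ (□F⊆□G ψ □ψ))
Prec-trans S4×S5 φ □F⊆□G □G⊆□H = λ χ □χ → □G⊆□H χ (□F⊆□G χ □χ)
Prec-trans SSL   φ (□F⊆□G , F≈G) (□G⊆□H , G≈H) =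
  (λ χ □χ → □G⊆□H χ (□F⊆□G χ □χ)) ,
  (λ p → mk⇔ (λ x → Equivalence.to (G≈H p) (Equivalence.to (F≈G p) x))
             (λ x → Equivalence.from (F≈G p) (Equivalence.from (G≈H p) x)))

¬¬-∀-Fin : ∀ {n} {Q : Fin n → Set} → (∀ i → ¬ ¬ Q i) → ¬ ¬ (∀ i → Q i)
¬¬-∀-Fin {zero}      _   k = k (λ ())
¬¬-∀-Fin {suc n} {Q} ¬¬Q k =
  ¬¬Q fzero λ q₀ → ¬¬-∀-Fin {Q = λ i → Q (fsuc i)} (λ i → ¬¬Q (fsuc i)) λ qs →
    k λ { fzero → q₀ ; (fsuc i) → qs i }

-- To bound mcl(≤_X) we may assume ≼_X decidable on the enumerated tableau-sets:
-- decidability holds up to double negation and the bound l ≤ b is itself decidable.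
mcl-assuming-decidable : ∀ X φ (L : List (SfSet φ)) b →
  ((∀ i j → Dec (Prec X φ (lookup L i) (lookup L j))) → MclAtMost (Leq X φ L) b) →
  MclAtMost (Leq X φ L) b
mcl-assuming-decidable X φ L b bound l chain =
  decidable-stable (l ≤? b) λ l≰b →
    ¬¬-∀-Fin (λ i → ¬¬-∀-Fin (λ j → ¬¬-excluded-middle)) λ ≼? → l≰b (bound ≼? l chain)

corollary8p2 : (X : Logic) (φ : Fm) (L : List (SfSet φ)) → Enumerates X φ L →
    ((X ≡ K4×S5 ⊎ X ≡ S4×S5) → MclAtMost (Leq X φ L) (4 * length L))
    × (X ≡ SSL → MclAtMost (Leq X φ L) (2 * length L))
corollary8p2 X φ L _ = with-forth , without-forth
  where
  module ≤X (≼? : ∀ i j → Dec (Prec X φ (lookup L i) (lookup L j))) =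
    BackAndForth (λ i j → Prec X φ (lookup L i) (lookup L j)) ≼? (Prec-trans X φ)

  with-forth : (X ≡ K4×S5 ⊎ X ≡ S4×S5) → MclAtMost (Leq X φ L) (4 * length L)
  with-forth (inj₁ refl) = mcl-assuming-decidable X φ L _ λ ≼? → Ranking.mcl-bound (≤X.back-forth-ranking ≼? tt)
  with-forth (inj₂ refl) = mcl-assuming-decidable X φ L _ λ ≼? → Ranking.mcl-bound (≤X.back-forth-ranking ≼? tt)

  without-forth : X ≡ SSL → MclAtMost (Leq X φ L) (2 * length L)
  without-forth refl = mcl-assuming-decidable X φ L _ λ ≼? → Ranking.mcl-bound (≤X.back-ranking ≼? (λ ()))
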